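{- There is an absolute constant $c>0$ such that for every Boolean function $f:\{0,1\}^n\to\{0,1\}$, (1) $\mathrm{D}(f)\le c\,\mathrm{C}^*_{\min}(f)\cdot\mathrm{bs}(f)$, and (2) $\mathrm{D}(f)\le c\,\mathrm{C}^*_{\min}(f)\cdot\deg(f)$.
   Context: A subcube is a set $\{y\in\{0,1\}^n: y_i=a_i\ \forall i\in I\}$ for some $I\subseteq[n]$, $a\in\{0,1\}^I$; its co-dimension is $|I|$. $\mathrm{C}(f,x)$ is the minimum co-dimension of a subcube containing $x$ on which $f$ is constant. $\mathrm{C}_{\min}(f)=\min_x\mathrm{C}(f,x)$. $\mathrm{C}^*_{\min}(f)=\max_{C}\mathrm{C}_{\min}(f|_C)$, the maximum over all subcubes $C$, where $f|_C$ is viewed as a Boolean function on the free coordinates of $C$. $\mathrm{D}(f)$ is the minimum depth of a deterministic decision tree (querying single input bits) computing $f$. For $B\subseteq[n]$, $x^{\oplus B}$ is $x$ with bits in $B$ flipped; $B$ is a sensitive block of $x$ if $f(x^{\oplus B})\ne f(x)$; $\mathrm{bs}(f)=\max_x$ (maximum number of pairwise disjoint sensitive blocks of $x$). $\deg(f)$ is the degree of the unique multilinear real polynomial agreeing with $f$ on $\{0,1\}^n$. -}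

module Defs where

open import Data.Nat using (ℕ; zero; suc; _+_; _≤_)
open import Data.Fin using (Fin; zero; suc)
open import Data.Bool using (Bool; true; false; if_then_else_; _xor_)
open import Data.Maybe using (Maybe; just; nothing; is-just)
open import Data.Product using (Σ; ∃; ∃-syntax; _×_; _,_)
open import Data.Sum using (_⊎_)
open import Data.Rational using (ℚ; 0ℚ; 1ℚ) renaming (_+_ to _+ℚ_; _*_ to _*ℚ_)
open import Data.Vec.Functional using (Vector; _∷_; insertAt)
open import Relation.Binary.PropositionalEquality using (_≡_; _≢_)
open import Relation.Nullary using (¬_)

Input : ℕ → Set
Input n = Fin n → Bool

BFun : ℕ → Set
BFun n = Input n → Bool

count : ∀ {n} → (Fin n → Bool) → ℕ
count {zero}  v = 0
count {suc n} v = (if v zero then 1 else 0) + count (λ i → v (suc i))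

IsMin : (ℕ → Set) → ℕ → Set
IsMin P m = P m × (∀ k → P k → m ≤ k)

IsMax : (ℕ → Set) → ℕ → Set
IsMax P m = P m × (∀ k → P k → k ≤ m)

-- Subcubes: a partial assignment ρ; ρ i = just a means y_i = a is fixed (i ∈ I)
Subcube : ℕ → Set
Subcube n = Fin n → Maybe Bool

_∈C_ : ∀ {n} → Input n → Subcube n → Set
x ∈C ρ = ∀ i a → ρ i ≡ just a → x i ≡ a

codim : ∀ {n} → Subcube n → ℕ
codim ρ = count (λ i → is-just (ρ i))

ConstantOn : ∀ {n} → BFun n → Subcube n → Set
ConstantOn f ρ = ∀ y z → y ∈C ρ → z ∈C ρ → f y ≡ f z

CertIs : ∀ {n} → BFun n → Input n → ℕ → Set
CertIs f x = IsMin (λ k → Σ (Subcube _) λ ρ → x ∈C ρ × ConstantOn f ρ × codim ρ ≡ k)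

CminIs : ∀ {n} → BFun n → ℕ → Set
CminIs f = IsMin (λ k → ∃[ x ] CertIs f x k)

-- Restrictions of f to subcubes, viewed as functions of the free coordinates
-- (in their original order): obtained by fixing coordinates one at a time.
fix : ∀ {n} → Fin (suc n) → Bool → BFun (suc n) → BFun n
fix i b f y = f (insertAt y i b)

data Restriction : ∀ {n m} → BFun n → BFun m → Set where
  here : ∀ {n} {f : BFun n} → Restriction f f
  step : ∀ {n m} {f : BFun (suc n)} {g : BFun m} (i : Fin (suc n)) (b : Bool) →
         Restriction (fix i b f) g → Restriction f g

CstarMinIs : ∀ {n} → BFun n → ℕ → Set
CstarMinIs f = IsMax (λ k → Σ ℕ λ m → Σ (BFun m) λ g → Restriction f g × CminIs g k)

data DTree (n : ℕ) : Set where
  leaf : Bool → DTree n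
  node : Fin n → DTree n → DTree n → DTree n

eval : ∀ {n} → DTree n → Input n → Bool
eval (leaf b) x = b
eval (node i l r) x = if x i then eval r x else eval l x

depth : ∀ {n} → DTree n → ℕ
depth (leaf b) = 0
depth (node i l r) = suc (depth l Data.Nat.⊔ depth r)

DIs : ∀ {n} → BFun n → ℕ → Set
DIs {n} f = IsMin (λ k → Σ (DTree n) λ t → (∀ x → eval t x ≡ f x) × depth t ≡ k)

flip : ∀ {n} → Input n → (Fin n → Bool) → Input n
flip x B i = x i xor B i

Sensitive : ∀ {n} → BFun n → Input n → (Fin n → Bool) → Set
Sensitive f x B = f (flip x B) ≢ f x

PairwiseDisjoint : ∀ {n k} → (Fin k → (Fin n → Bool)) → Set
PairwiseDisjoint Bs = ∀ j j' → j ≢ j' → ∀ i → Bs j i ≡ true → Bs j' i ≡ false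

BsIs : ∀ {n} → BFun n → ℕ → Set
BsIs {n} f = IsMax (λ k → Σ (Input n) λ x → Σ (Fin k → (Fin n → Bool)) λ Bs →
                     PairwiseDisjoint Bs × (∀ j → Sensitive f x (Bs j)))

-- Multilinear polynomials over ℚ: coefficient a(S) for each S ⊆ [n]
MLPoly : ℕ → Set
MLPoly n = (Fin n → Bool) → ℚ

bit : Bool → ℚ
bit true = 1ℚ
bit false = 0ℚ

monomial : ∀ {n} → (Fin n → Bool) → Input n → ℚ
monomial {zero}  S x = 1ℚ
monomial {suc n} S x = (if S zero then bit (x zero) else 1ℚ) *ℚ monomial (λ i → S (suc i)) (λ i → x (suc i))

sumSubsets : ∀ {n} → ((Fin n → Bool) → ℚ) → ℚ
sumSubsets {zero}  g = g (λ ())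
sumSubsets {suc n} g = sumSubsets (λ S → g (false ∷ S)) +ℚ sumSubsets (λ S → g (true ∷ S))

evalPoly : ∀ {n} → MLPoly n → Input n → ℚ
evalPoly a x = sumSubsets (λ S → a S *ℚ monomial S x)

Represents : ∀ {n} → BFun n → MLPoly n → Set
Represents f a = ∀ x → evalPoly a x ≡ bit (f x)

-- degree of a multilinear polynomial (zero polynomial has degree 0)
HasDegree : ∀ {n} → MLPoly n → ℕ → Set
HasDegree a d = (∀ S → a S ≢ 0ℚ → count S ≤ d) × (d ≡ 0 ⊎ ∃[ S ] (a S ≢ 0ℚ × count S ≡ d))

DegIs : ∀ {n} → BFun n → ℕ → Set
DegIs f d = ∃[ a ] (Represents f a × HasDegree a d)

{-# OPTIONS --safe #-}
module Submission where

-- Build the tree greedily. On the current subcube ρ take a minimum certificate of f|ρ,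
-- of co-dimension C_min(f|ρ) ≤ C*_min(f), query all its coordinates, and recurse on each
-- resulting subcube ρ', which fixes a certificate of some x0 ∈ ρ. Then
--  * every y ∈ ρ' with f y ≠ f x0 has, besides its blocks among the free coordinates of
--    ρ', the sensitive block "certificate coordinates where y differs from x0"; so
--    bs_0 + bs_1 of the restriction drops in every round, giving 2 bs(f) rounds;
--  * every derivative ∂_S f with S free in ρ' equals its value at the certified points,
--    where f is constant, up to derivatives of higher order; so the highest order of a
--    non-vanishing derivative, deg(f|ρ), drops in every round, giving deg(f) rounds.
-- Minimum certificates exist only classically, so the tree is built under a double
-- negation, which is harmless since the conclusion d ≤ D is decidable.

open import Defs
open import Data.Nat using (ℕ; zero; suc; _+_; _*_; _≤_; _<_; _≤?_; z≤n; s≤s)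
open import Data.Nat.Tactic.RingSolver using (solve-∀)
open import Data.Nat.Properties
  using (≤-trans; ≤-refl; ≤-reflexive; n≤1+n; ⊔-lub; +-monoˡ-≤; *-monoˡ-≤; m≤m+n; *-suc; +-suc;
         suc-injective; m≤n⇒m<n∨m≡n; ≮⇒≥; <⇒≱; 1+n≰n; module ≤-Reasoning)
open import Data.Fin using (Fin; zero; suc) renaming (_≟_ to _≟ᶠ_)
open import Data.Bool using (Bool; true; false; not; _∧_; _xor_; if_then_else_)
open import Data.Bool.Properties using (¬-not; xor-same; xor-assoc; xor-identityʳ)
  renaming (_≟_ to _≟ᵇ_)
open import Data.Maybe using (just; nothing; fromMaybe)
open import Data.Maybe.Properties using (just-injective)
open import Data.Product using (Σ; ∃-syntax; _×_; _,_; proj₁; proj₂)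
open import Data.Sum using (_⊎_; inj₁; inj₂)
open import Data.Empty using (⊥)
open import Data.List using (List; []; _∷_; length; map; allFin)
open import Data.List.Relation.Unary.All as All using (All; []; _∷_)
open import Data.List.Relation.Unary.All.Properties using (map⁺; ¬All⇒Any¬)
open import Data.List.Properties using (length-map)
open import Data.List.Relation.Unary.Any using (here; there; any?)
open import Data.List.Membership.Propositional using (_∈_; find)
open import Data.List.Relation.Unary.Unique.Propositional using (Unique)
open import Data.List.Relation.Unary.AllPairs using ([]; _∷_)
open import Data.List.Membership.Propositional.Properties using (∈-allFin; ∈-map⁺)
open import Data.Vec.Functional using (Vector; updateAt; insertAt) renaming (_∷_ to _◂_)
open import Data.Vec.Functional.Properties
  using (updateAt-updates; updateAt-minimal; updateAt-id-local; updateAt-cong-local; updateAt-commutes)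
open import Data.Rational using (ℚ; 0ℚ; 1ℚ) renaming (_+_ to _+ℚ_; _*_ to _*ℚ_; _-_ to _-ℚ_)
import Data.Rational.Properties as ℚ
open import Data.Rational.Solver using (module +-*-Solver)
open +-*-Solver using (solve; _:+_; _:-_; _:*_; _:=_)
open import Algebra.Properties.Group ℚ.+-0-group using (x∙y⁻¹≈ε⇒x≈y)
open import Function using (_∘_; const)
open import Function.Definitions using (Congruent)
open import Relation.Binary.PropositionalEquality
  using (_≡_; _≢_; refl; sym; trans; cong; cong₂; subst; _≗_; module ≡-Reasoning)
open import Relation.Nullary using (¬_; Dec; yes; no; does; contradiction)
open import Relation.Nullary.Negation using (¬¬-Monad)
open import Relation.Nullary.Decidable using (decidable-stable)
open import Effect.Monad using (RawMonad)
open import Level using (0ℓ)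
open RawMonad (¬¬-Monad {0ℓ})

private variable
  n m : ℕ

_∈?_ : (i : Fin n) (J : List (Fin n)) → Dec (i ∈ J)
i ∈? J = any? (i ≟ᶠ_) J

set : Input n → Fin n → Bool → Input n
set x i b = updateAt x i (const b)

flipAt : Input n → Fin n → Input n
flipAt x i = updateAt x i not

updateAt-resp-≗ : ∀ {A : Set} {x y : Vector A n} (i : Fin n) {g : A → A} →
                  x ≗ y → updateAt x i g ≗ updateAt y i g
updateAt-resp-≗ zero {g} x≗y zero    = cong g (x≗y zero)
updateAt-resp-≗ zero    x≗y (suc j) = x≗y (suc j)
updateAt-resp-≗ (suc i) x≗y zero    = x≗y zero
updateAt-resp-≗ (suc i) x≗y (suc j) = updateAt-resp-≗ i (x≗y ∘ suc) j

set-≗ : ∀ (x : Input n) i {b} → x i ≡ b → set x i b ≗ x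
set-≗ x i xi≡b = updateAt-id-local i x (sym xi≡b)

set-≗-flipAt : ∀ (x : Input n) i {b} → x i ≢ b → set x i b ≗ flipAt x i
set-≗-flipAt x i xi≢b = updateAt-cong-local i x (¬-not (xi≢b ∘ sym))

flipAt-comm : ∀ (x : Input n) i j → flipAt (flipAt x i) j ≗ flipAt (flipAt x j) i
flipAt-comm x i j with i ≟ᶠ j
... | yes refl = λ _ → refl
... | no i≢j   = updateAt-commutes j i (i≢j ∘ sym) x

eval-cong : (t : DTree n) → Congruent _≗_ _≡_ (eval t)
eval-cong (leaf b)     x≗y = refl
eval-cong (node i l r) {x} {y} x≗y rewrite x≗y i with y i
... | true  = eval-cong r x≗y
... | false = eval-cong l x≗y

set-preserves : ∀ {A : Set} (h : Input n → A) → Congruent _≗_ _≡_ h → ∀ w j b →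
                (w j ≢ b → h (flipAt w j) ≡ h w) → h (set w j b) ≡ h w
set-preserves h h-cong w j b flip-preserves with w j ≟ᵇ b
... | yes wj≡b = h-cong (set-≗ w j wj≡b)
... | no  wj≢b = trans (h-cong (set-≗-flipAt w j wj≢b)) (flip-preserves wj≢b)

Free Fixed : Subcube n → Fin n → Set
Free  ρ i = ρ i ≡ nothing
Fixed ρ i = ρ i ≢ nothing

_⊑_ : Subcube n → Subcube n → Set
ρ' ⊑ ρ = ∀ i a → ρ i ≡ just a → ρ' i ≡ just a

⊑-refl : {ρ : Subcube n} → ρ ⊑ ρ
⊑-refl _ _ ρi≡a = ρi≡a

⊑-trans : {ρ ρ' ρ'' : Subcube n} → ρ'' ⊑ ρ' → ρ' ⊑ ρ → ρ'' ⊑ ρ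
⊑-trans ρ''⊑ρ' ρ'⊑ρ i a = ρ''⊑ρ' i a ∘ ρ'⊑ρ i a

⊑-∈C : {ρ ρ' : Subcube n} {x : Input n} → ρ' ⊑ ρ → x ∈C ρ' → x ∈C ρ
⊑-∈C ρ'⊑ρ x∈ρ' i a = x∈ρ' i a ∘ ρ'⊑ρ i a

⊑-Free : {ρ ρ' : Subcube n} → ρ' ⊑ ρ → ∀ {i} → Free ρ' i → Free ρ i
⊑-Free {ρ = ρ} ρ'⊑ρ {i} ρ'i≡nothing with ρ i in ρi
... | nothing = refl
... | just a with () ← trans (sym ρ'i≡nothing) (ρ'⊑ρ i a ρi)

⊑-Fixed : {ρ ρ' : Subcube n} → ρ' ⊑ ρ → ∀ {i a} → ρ i ≡ just a → Fixed ρ' i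
⊑-Fixed ρ'⊑ρ {i} {a} ρi≡a ρ'i≡nothing with () ← trans (sym (ρ'⊑ρ i a ρi≡a)) ρ'i≡nothing

updateAt-∈C : {ρ : Subcube n} {x : Input n} (i : Fin n) {g : Bool → Bool} →
              x ∈C ρ → (∀ a → ρ i ≡ just a → g (x i) ≡ a) → updateAt x i g ∈C ρ
updateAt-∈C {x = x} i x∈ρ g-fits j a ρj≡a with i ≟ᶠ j
... | yes refl = trans (updateAt-updates i x) (g-fits a ρj≡a)
... | no  i≢j  = trans (updateAt-minimal j i x (i≢j ∘ sym)) (x∈ρ j a ρj≡a)

flipAt-∈C : {ρ : Subcube n} {x : Input n} {i : Fin n} → Free ρ i → x ∈C ρ → flipAt x i ∈C ρ
flipAt-∈C ρi≡nothing x∈ρ = updateAt-∈C _ x∈ρ λ a ρi≡a → contradiction (trans (sym ρi≡nothing) ρi≡a) λ ()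

≢⇒Free : {ρ : Subcube n} {y z : Input n} {i : Fin n} → y ∈C ρ → z ∈C ρ → y i ≢ z i → Free ρ i
≢⇒Free {ρ = ρ} {i = i} y∈ρ z∈ρ yi≢zi with ρ i in ρi
... | nothing = refl
... | just a  = contradiction (trans (y∈ρ i a ρi) (sym (z∈ρ i a ρi))) yi≢zi

anyPoint : Subcube n → Input n
anyPoint ρ i = fromMaybe false (ρ i)

anyPoint-∈C : (ρ : Subcube n) → anyPoint ρ ∈C ρ
anyPoint-∈C ρ i a ρi≡a rewrite ρi≡a = refl

fixAt : Subcube n → Fin n → Bool → Subcube n
fixAt ρ i a = updateAt ρ i (const (just a))

fixAt-⊑ : {ρ : Subcube n} {i : Fin n} (a : Bool) → Free ρ i → fixAt ρ i a ⊑ ρ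
fixAt-⊑ {ρ = ρ} {i} a ρi≡nothing j b ρj≡b with i ≟ᶠ j
... | yes refl with () ← trans (sym ρi≡nothing) ρj≡b
... | no  i≢j  = trans (updateAt-minimal j i ρ (i≢j ∘ sym)) ρj≡b

fixAt-fixes : (ρ : Subcube n) (i : Fin n) (a : Bool) → fixAt ρ i a i ≡ just a
fixAt-fixes ρ i a = updateAt-updates i ρ

fixAt-∈C : {ρ : Subcube n} {x : Input n} {i : Fin n} {a : Bool} → x ∈C ρ → x i ≡ a → x ∈C fixAt ρ i a
fixAt-∈C {ρ = ρ} {i = i} x∈ρ xi≡a j b ρ'j≡b with i ≟ᶠ j
... | yes refl = trans xi≡a (just-injective (trans (sym (fixAt-fixes ρ i _)) ρ'j≡b))
... | no  i≢j  = x∈ρ j b (trans (sym (updateAt-minimal j i ρ (i≢j ∘ sym))) ρ'j≡b)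

AgreeOn : List (Fin n) → Input n → Input n → Set
AgreeOn J x y = ∀ {i} → i ∈ J → x i ≡ y i

patch : List (Fin n) → Input n → Input n → Input n
patch J x0 y i = if does (i ∈? J) then x0 i else y i

patch-agrees : ∀ J (x0 y : Input n) → AgreeOn J (patch J x0 y) x0
patch-agrees J x0 y {i} i∈J with i ∈? J
... | yes _   = refl
... | no  i∉J = contradiction i∈J i∉J

patch-∈C : {ρ : Subcube n} → ∀ J {x0 y : Input n} → x0 ∈C ρ → y ∈C ρ → patch J x0 y ∈C ρ
patch-∈C J x0∈ρ y∈ρ i a ρi≡a with i ∈? J
... | yes _ = x0∈ρ i a ρi≡a
... | no  _ = y∈ρ i a ρi≡a

patch-∷ : ∀ j J (x0 y : Input n) → patch (j ∷ J) x0 y ≗ set (patch J x0 y) j (x0 j)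
patch-∷ j J x0 y i with i ≟ᶠ j
... | yes refl = sym (updateAt-updates i (patch J x0 y))
... | no  i≢j  = sym (updateAt-minimal i j (patch J x0 y) i≢j)

flipAt-AgreeOn : ∀ {J : List (Fin n)} {w x : Input n} {i} → ¬ i ∈ J → AgreeOn J w x → AgreeOn J (flipAt w i) x
flipAt-AgreeOn {w = w} {i = i} i∉J agree {j} j∈J with i ≟ᶠ j
... | yes refl = contradiction j∈J i∉J
... | no  i≢j  = trans (updateAt-minimal j i w (i≢j ∘ sym)) (agree j∈J)

patch-preserves : ∀ {A : Set} {ρ : Subcube n} (h : Input n → A) → Congruent _≗_ _≡_ h →
                  ∀ J {x0 : Input n} → x0 ∈C ρ →
                  (∀ w j → w ∈C ρ → j ∈ J → h (set w j (x0 j)) ≡ h w) →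
                  ∀ z → z ∈C ρ → h (patch J x0 z) ≡ h z
patch-preserves h h-cong []      x0∈ρ overwrite z z∈ρ = refl
patch-preserves h h-cong (j ∷ J) {x0} x0∈ρ overwrite z z∈ρ = begin
  h (patch (j ∷ J) x0 z)            ≡⟨ h-cong (patch-∷ j J x0 z) ⟩
  h (set (patch J x0 z) j (x0 j))   ≡⟨ overwrite _ j (patch-∈C J x0∈ρ z∈ρ) (here refl) ⟩
  h (patch J x0 z)                  ≡⟨ patch-preserves h h-cong J x0∈ρ (λ w i w∈ρ → overwrite w i w∈ρ ∘ there) z z∈ρ ⟩
  h z                               ∎
  where open ≡-Reasoning

module Construction {n} (f : BFun n) (cs : ℕ) where

  TreeOn : Subcube n → ℕ → Set
  TreeOn ρ D = Σ (DTree n) λ t → (∀ x → x ∈C ρ → eval t x ≡ f x) × depth t ≤ D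

  TreeOn-mono : ∀ {ρ D D'} → D ≤ D' → TreeOn ρ D → TreeOn ρ D'
  TreeOn-mono D≤D' (t , computes , depth≤D) = t , computes , ≤-trans depth≤D D≤D'

  leaf-on : ∀ {ρ} D → ConstantOn f ρ → TreeOn ρ D
  leaf-on {ρ} D constant =
    leaf (f (anyPoint ρ)) , (λ x x∈ρ → constant _ x (anyPoint-∈C ρ) x∈ρ) , z≤n

  node-on : ∀ {ρ i D} → TreeOn (fixAt ρ i false) D → TreeOn (fixAt ρ i true) D → TreeOn ρ (suc D)
  node-on {ρ} {i} (l , l-computes , l≤D) (r , r-computes , r≤D) =
    node i l r , computes , s≤s (⊔-lub l≤D r≤D)
    where
    computes : ∀ x → x ∈C ρ → eval (node i l r) x ≡ f x
    computes x x∈ρ with x i in xi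
    ... | true  = r-computes x (fixAt-∈C x∈ρ xi)
    ... | false = l-computes x (fixAt-∈C x∈ρ xi)

  query-all : ∀ D (J : List (Fin n)) ρ →
              (∀ ρ' → ρ' ⊑ ρ → All (Fixed ρ') J → ¬ ¬ TreeOn ρ' D) →
              ¬ ¬ TreeOn ρ (length J + D)
  query-all D []      ρ trees = trees ρ ⊑-refl []
  query-all D (i ∷ J) ρ trees with ρ i in ρi
  ... | just a  = TreeOn-mono (n≤1+n _) <$>
                  query-all D J ρ λ ρ' ρ'⊑ρ fixed → trees ρ' ρ'⊑ρ (⊑-Fixed ρ'⊑ρ ρi ∷ fixed)
  ... | nothing = do
    l ← query-all D J (fixAt ρ i false) (branch false)
    r ← query-all D J (fixAt ρ i true) (branch true)
    pure (node-on l r)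
    where
    branch : ∀ b ρ' → ρ' ⊑ fixAt ρ i b → All (Fixed ρ') J → ¬ ¬ TreeOn ρ' D
    branch b ρ' ρ'⊑ fixed =
      trees ρ' (⊑-trans ρ'⊑ (fixAt-⊑ b ρi)) (⊑-Fixed ρ'⊑ (fixAt-fixes ρ i b) ∷ fixed)

  record Certificate (ρ : Subcube n) : Set where
    field
      coords      : List (Fin n)
      size        : length coords ≤ cs
      point       : Input n
      point-∈C    : point ∈C ρ
      coords-free : All (Free ρ) coords
      certifies   : ∀ x → x ∈C ρ → AgreeOn coords x point → f x ≡ f point

  open Certificate public

  Settles : ∀ {ρ} → Certificate ρ → Subcube n → Set
  Settles {ρ} C ρ' = ρ' ⊑ ρ × All (Fixed ρ') (coords C)

  Decreasing : (Subcube n → ℕ → Set) → Set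
  Decreasing Φ = ∀ ρ k → Φ ρ (suc k) →
                 ConstantOn f ρ ⊎ (∀ (C : Certificate ρ) ρ' → Settles C ρ' → Φ ρ' k)

  tree-from-potential : (∀ ρ → ¬ ¬ Certificate ρ) → (Φ : Subcube n → ℕ → Set) →
                        (∀ {ρ} → Φ ρ 0 → ConstantOn f ρ) → Decreasing Φ →
                        ∀ k ρ → Φ ρ k → ¬ ¬ TreeOn ρ (cs * k)
  tree-from-potential certificate Φ zero-constant decreasing zero ρ φ =
    pure (leaf-on _ (zero-constant φ))
  tree-from-potential certificate Φ zero-constant decreasing (suc k) ρ φ
    with decreasing ρ k φ
  ... | inj₁ constant = pure (leaf-on _ constant)
  ... | inj₂ drops = do
    C ← certificate ρ
    TreeOn-mono (≤-trans (+-monoˡ-≤ (cs * k) (size C)) (≤-reflexive (sym (*-suc cs k)))) <$>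
      query-all (cs * k) (coords C) ρ λ ρ' ρ'⊑ρ fixed →
        tree-from-potential certificate Φ zero-constant decreasing k ρ' (drops C ρ' (ρ'⊑ρ , fixed))

-- Restrictions to subcubes

data Fixing : ℕ → ℕ → Set where
  done : Fixing n n
  fix∷ : Fin (suc n) → Bool → Fixing n m → Fixing (suc n) m

restrict : Fixing n m → BFun n → BFun m
restrict done         f = f
restrict (fix∷ i b P) f = restrict P (fix i b f)

restrict-Restriction : (P : Fixing n m) (f : BFun n) → Restriction f (restrict P f)
restrict-Restriction done         f = here
restrict-Restriction (fix∷ i b P) f = step i b (restrict-Restriction P (fix i b f))

extend : Fixing n m → Input m → Input n
extend done         y = y
extend (fix∷ i b P) y = insertAt (extend P y) i b

restrict-extend : (P : Fixing n m) (f : BFun n) (y : Input m) → restrict P f y ≡ f (extend P y)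
restrict-extend done         f y = refl
restrict-extend (fix∷ i b P) f y = restrict-extend P (fix i b f) y

insertAt-resp-≗ : {x y : Input n} (i : Fin (suc n)) (b : Bool) → x ≗ y → insertAt x i b ≗ insertAt y i b
insertAt-resp-≗         zero    b x≗y zero    = refl
insertAt-resp-≗         zero    b x≗y (suc j) = x≗y j
insertAt-resp-≗ {suc n} (suc i) b x≗y zero    = x≗y zero
insertAt-resp-≗ {suc n} (suc i) b x≗y (suc j) = insertAt-resp-≗ i b (x≗y ∘ suc) j

extend-resp-≗ : (P : Fixing n m) {y y' : Input m} → y ≗ y' → extend P y ≗ extend P y'
extend-resp-≗ done         y≗y' = y≗y'
extend-resp-≗ (fix∷ i b P) y≗y' = insertAt-resp-≗ i b (extend-resp-≗ P y≗y')

restrict-cong : (P : Fixing n m) {f : BFun n} → Congruent _≗_ _≡_ f → Congruent _≗_ _≡_ (restrict P f)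
restrict-cong P {f} f-cong {y} {y'} y≗y' = begin
  restrict P f y    ≡⟨ restrict-extend P f y ⟩
  f (extend P y)    ≡⟨ f-cong (extend-resp-≗ P y≗y') ⟩
  f (extend P y')   ≡⟨ restrict-extend P f y' ⟨
  restrict P f y'   ∎
  where open ≡-Reasoning

shift : Fixing n m → Fixing (suc n) (suc m)
shift done         = done
shift (fix∷ i b P) = fix∷ (suc i) b (shift P)

extend-shift-zero : (P : Fixing n m) (y : Input (suc m)) → extend (shift P) y zero ≡ y zero
extend-shift-zero done         y = refl
extend-shift-zero (fix∷ i b P) y = extend-shift-zero P y

extend-shift-suc : (P : Fixing n m) (y : Input (suc m)) →
                   (λ j → extend (shift P) y (suc j)) ≗ extend P (y ∘ suc)
extend-shift-suc done         y j = refl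
extend-shift-suc (fix∷ i b P) y j = insertAt-resp-≗ i b (extend-shift-suc P y) j

record Parametrization (ρ : Subcube n) : Set where
  field
    {dim}      : ℕ
    fixing     : Fixing n dim
    emb        : Fin dim → Fin n
    extend-∈C  : ∀ y → extend fixing y ∈C ρ
    extend-emb : ∀ y j → extend fixing y (emb j) ≡ y j
    emb-free   : ∀ j → Free ρ (emb j)
    emb-onto   : ∀ i → Free ρ i → ∃[ j ] emb j ≡ i

  extend-restores : ∀ {z} → z ∈C ρ → extend fixing (z ∘ emb) ≗ z
  extend-restores {z} z∈ρ i with ρ i in ρi
  ... | just a  = trans (extend-∈C (z ∘ emb) i a ρi) (sym (z∈ρ i a ρi))
  ... | nothing with emb-onto i ρi
  ... | j , refl = extend-emb (z ∘ emb) j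

parametrize : (ρ : Subcube n) → Parametrization ρ
parametrize {zero} ρ = record
  { fixing = done ; emb = λ () ; extend-∈C = λ _ () ; extend-emb = λ _ ()
  ; emb-free = λ () ; emb-onto = λ () }
parametrize {suc n} ρ with ρ zero in ρ0 | parametrize (ρ ∘ suc)
... | just a  | R = record
  { fixing = fix∷ zero a fixing ; emb = suc ∘ emb ; extend-∈C = extend-∈C'
  ; extend-emb = extend-emb ; emb-free = emb-free ; emb-onto = emb-onto' }
  where
  open Parametrization R
  extend-∈C' : ∀ y → extend (fix∷ zero a fixing) y ∈C ρ
  extend-∈C' y zero    b ρ0≡b = just-injective (trans (sym ρ0) ρ0≡b)
  extend-∈C' y (suc i) b ρi≡b = extend-∈C y i b ρi≡b
  emb-onto' : ∀ i → Free ρ i → ∃[ j ] suc (emb j) ≡ i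
  emb-onto' zero    ρ0≡nothing with () ← trans (sym ρ0) ρ0≡nothing
  emb-onto' (suc i) ρi≡nothing = let j , j↦i = emb-onto i ρi≡nothing in j , cong suc j↦i
... | nothing | R = record
  { fixing = shift fixing ; emb = emb' ; extend-∈C = extend-∈C' ; extend-emb = extend-emb'
  ; emb-free = emb-free' ; emb-onto = emb-onto' }
  where
  open Parametrization R
  emb' : Fin (suc dim) → Fin (suc n)
  emb' zero    = zero
  emb' (suc j) = suc (emb j)
  extend-∈C' : ∀ y → extend (shift fixing) y ∈C ρ
  extend-∈C' y zero    b ρ0≡b with () ← trans (sym ρ0) ρ0≡b
  extend-∈C' y (suc i) b ρi≡b = trans (extend-shift-suc fixing y i) (extend-∈C (y ∘ suc) i b ρi≡b)
  extend-emb' : ∀ y j → extend (shift fixing) y (emb' j) ≡ y j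
  extend-emb' y zero    = extend-shift-zero fixing y
  extend-emb' y (suc j) = trans (extend-shift-suc fixing y (emb j)) (extend-emb (y ∘ suc) j)
  emb-free' : ∀ j → Free ρ (emb' j)
  emb-free' zero    = ρ0
  emb-free' (suc j) = emb-free j
  emb-onto' : ∀ i → Free ρ i → ∃[ j ] emb' j ≡ i
  emb-onto' zero    _          = zero , refl
  emb-onto' (suc i) ρi≡nothing = let j , j↦i = emb-onto i ρi≡nothing in suc j , cong suc j↦i

-- Minimum certificates

¬¬-least : (P : ℕ → Set) → ∀ k → P k → ¬ ¬ Σ ℕ (IsMin P)
¬¬-least P k pk no-least = none-below (suc k) k ≤-refl pk
  where
  none-below : ∀ k j → j < k → ¬ P j
  none-below (suc k) j (s≤s j≤k) pj with m≤n⇒m<n∨m≡n j≤k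
  ... | inj₁ j<k  = none-below k j j<k pj
  ... | inj₂ refl = no-least (j , pj , λ i pi → ≮⇒≥ λ i<j → none-below j i i<j pi)

fixedCoords : Subcube m → List (Fin m)
fixedCoords {zero}  τ = []
fixedCoords {suc m} τ with τ zero
... | just _  = zero ∷ map suc (fixedCoords (τ ∘ suc))
... | nothing = map suc (fixedCoords (τ ∘ suc))

length-fixedCoords : (τ : Subcube m) → length (fixedCoords τ) ≡ codim τ
length-fixedCoords {zero}  τ = refl
length-fixedCoords {suc m} τ with τ zero
... | just _  = cong suc (trans (length-map suc (fixedCoords (τ ∘ suc))) (length-fixedCoords (τ ∘ suc)))
... | nothing = trans (length-map suc (fixedCoords (τ ∘ suc))) (length-fixedCoords (τ ∘ suc))

∈-fixedCoords : (τ : Subcube m) {j : Fin m} {a : Bool} → τ j ≡ just a → j ∈ fixedCoords τ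
∈-fixedCoords {suc m} τ {zero}  τj≡a with τ zero
∈-fixedCoords {suc m} τ {zero}  refl | just _ = here refl
∈-fixedCoords {suc m} τ {suc j} τj≡a with τ zero
... | just _  = there (∈-map⁺ suc (∈-fixedCoords (τ ∘ suc) τj≡a))
... | nothing = ∈-map⁺ suc (∈-fixedCoords (τ ∘ suc) τj≡a)

module _ {n} (f : BFun n) (f-cong : Congruent _≗_ _≡_ f) {cs : ℕ} (cstar : CstarMinIs f cs) where
  open Construction f cs

  -- A minimum certificate of f|ρ has co-dimension C_min(f|ρ) ≤ C*_min(f); its
  -- fixed coordinates, read back in ρ, certify f on ρ.
  certificate : ∀ ρ → ¬ ¬ Certificate ρ
  certificate ρ = do
    _ , C-g-y₀ ← ¬¬-least (λ k → Σ (Subcube dim) λ τ → y₀ ∈C τ × ConstantOn g τ × codim τ ≡ k)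
                          _ (τ₀ , (λ _ _ → just-injective) , τ₀-constant , refl)
    k , cmin ← ¬¬-least (λ k → ∃[ x ] CertIs g x k) _ (y₀ , C-g-y₀)
    pure (fromMinimal (proj₂ cstar k (dim , g , restrict-Restriction fixing f , cmin)) (proj₁ cmin))
    where
    open Parametrization (parametrize ρ)
    g : BFun dim
    g = restrict fixing f
    y₀ : Input dim
    y₀ = const false
    τ₀ : Subcube dim
    τ₀ = just ∘ y₀
    τ₀-constant : ConstantOn g τ₀
    τ₀-constant y z y∈τ₀ z∈τ₀ = restrict-cong fixing f-cong λ j → trans (y∈τ₀ j _ refl) (sym (z∈τ₀ j _ refl))
    fromMinimal : ∀ {k} → k ≤ cs → ∃[ x ] CertIs g x k → Certificate ρ
    fromMinimal k≤cs (x , (τ , x∈τ , τ-constant , codim≡k) , _) = record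
      { coords      = map emb (fixedCoords τ)
      ; size        = ≤-trans (≤-reflexive (trans (length-map emb (fixedCoords τ))
                                                    (trans (length-fixedCoords τ) codim≡k))) k≤cs
      ; point       = extend fixing x
      ; point-∈C    = extend-∈C x
      ; coords-free = map⁺ (All.tabulate λ {j} _ → emb-free j)
      ; certifies   = restores-value
      }
      where
      restores-value : ∀ z → z ∈C ρ → AgreeOn (map emb (fixedCoords τ)) z (extend fixing x) → f z ≡ f (extend fixing x)
      restores-value z z∈ρ agree = begin
        f z                     ≡⟨ f-cong (extend-restores z∈ρ) ⟨
        f (extend fixing y)     ≡⟨ restrict-extend fixing f y ⟨
        g y                     ≡⟨ τ-constant y x y∈τ x∈τ ⟩
        g x                     ≡⟨ restrict-extend fixing f x ⟩
        f (extend fixing x)     ∎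
        where
        open ≡-Reasoning
        y = z ∘ emb
        y∈τ : y ∈C τ
        y∈τ j a τj≡a = trans (agree (∈-map⁺ emb (∈-fixedCoords τ τj≡a)))
                             (trans (extend-emb x j) (x∈τ j a τj≡a))

-- Block sensitivity

disjoint-◂ : ∀ {k} {B : Fin n → Bool} {Bs : Fin k → Fin n → Bool} →
             (∀ j i → B i ≡ true → Bs j i ≡ true → ⊥) → PairwiseDisjoint Bs → PairwiseDisjoint (B ◂ Bs)
disjoint-◂ apart disjoint zero    zero     0≢0  = contradiction refl 0≢0
disjoint-◂ apart disjoint zero    (suc j') _ i Bi  = ¬-not (apart j' i Bi)
disjoint-◂ apart disjoint (suc j) zero     _ i Bji = ¬-not (λ Bi → apart j i Bi Bji)
disjoint-◂ apart disjoint (suc j) (suc j') j≢j' = disjoint j j' (j≢j' ∘ cong suc)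

diff : Input n → Input n → Fin n → Bool
diff y z i = y i xor z i

flip-diff : (y z : Input n) → flip y (diff y z) ≗ z
flip-diff y z i = trans (sym (xor-assoc (y i) (y i) (z i))) (cong (_xor z i) (xor-same (y i)))

module BlockSensitivity {n} (f : BFun n) (f-cong : Congruent _≗_ _≡_ f) (cs : ℕ) where
  open Construction f cs

  FreeBlock : Subcube n → (Fin n → Bool) → Set
  FreeBlock ρ B = ∀ i → B i ≡ true → Free ρ i

  -- bs_c(f|ρ) ≤ k, counting only blocks inside the free coordinates of ρ
  BsAtMost : Subcube n → Bool → ℕ → Set
  BsAtMost ρ c k = ∀ y → y ∈C ρ → f y ≡ c → (Bs : Fin (suc k) → Fin n → Bool) →
                   PairwiseDisjoint Bs → (∀ j → FreeBlock ρ (Bs j)) → ¬ (∀ j → Sensitive f y (Bs j))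

  BsPotential : Subcube n → ℕ → Set
  BsPotential ρ k = Σ ℕ λ k₀ → Σ ℕ λ k₁ → k₀ + k₁ ≡ k × BsAtMost ρ false k₀ × BsAtMost ρ true k₁

  BsAtMost-⊑ : ∀ {ρ ρ' c k} → ρ' ⊑ ρ → BsAtMost ρ c k → BsAtMost ρ' c k
  BsAtMost-⊑ ρ'⊑ρ bound y y∈ρ' fy≡c Bs disjoint free =
    bound y (⊑-∈C ρ'⊑ρ y∈ρ') fy≡c Bs disjoint λ j i Bji → ⊑-Free ρ'⊑ρ (free j i Bji)

  diff-free : ∀ {ρ y z} → y ∈C ρ → z ∈C ρ → FreeBlock ρ (diff y z)
  diff-free {y = y} y∈ρ z∈ρ i diff≡true = ≢⇒Free y∈ρ z∈ρ λ yi≡zi →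
    contradiction (trans (sym diff≡true) (trans (cong (y i xor_) (sym yi≡zi)) (xor-same (y i)))) λ ()

  BsAtMost-zero⇒≡ : ∀ {ρ c y z} → BsAtMost ρ c 0 → y ∈C ρ → z ∈C ρ → f y ≡ c → f y ≡ f z
  BsAtMost-zero⇒≡ {y = y} {z} bound y∈ρ z∈ρ fy≡c = decidable-stable (f y ≟ᵇ f z) λ fy≢fz →
    bound y y∈ρ fy≡c (λ _ → diff y z) (λ { zero zero 0≢0 → contradiction refl 0≢0 })
          (λ _ → diff-free y∈ρ z∈ρ) λ _ f-flip≡fy → fy≢fz (trans (sym f-flip≡fy) (f-cong (flip-diff y z)))

  BsAtMost-zero⇒constant : ∀ {ρ c} → BsAtMost ρ c 0 → ConstantOn f ρ
  BsAtMost-zero⇒constant {c = c} bound y z y∈ρ z∈ρ with f y ≟ᵇ c | f z ≟ᵇ c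
  ... | yes fy≡c | _        = BsAtMost-zero⇒≡ bound y∈ρ z∈ρ fy≡c
  ... | no _     | yes fz≡c = sym (BsAtMost-zero⇒≡ bound z∈ρ y∈ρ fz≡c)
  ... | no fy≢c  | no fz≢c  = trans (¬-not fy≢c) (sym (¬-not fz≢c))

  -- Inside a settled certificate of x0, every y with f y ≢ f x0 gains the new
  -- sensitive block "coordinates of the certificate where y and x0 differ".
  BsAtMost-settle : ∀ {ρ ρ' c k} (C : Certificate ρ) → Settles C ρ' → c ≢ f (point C) →
                    BsAtMost ρ c (suc k) → BsAtMost ρ' c k
  BsAtMost-settle {ρ} {ρ'} {c} C (ρ'⊑ρ , fixed) c≢fx0 bound y y∈ρ' fy≡c Bs disjoint free sensitive =
    bound y y∈ρ fy≡c (B ◂ Bs) (disjoint-◂ apart disjoint) free-◂ sensitive-◂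
    where
    J = coords C
    y∈ρ = ⊑-∈C ρ'⊑ρ y∈ρ'
    B : Fin n → Bool
    B i = does (i ∈? J) ∧ diff y (point C) i
    B-in-J : ∀ i → B i ≡ true → i ∈ J
    B-in-J i Bi with i ∈? J
    ... | yes i∈J = i∈J
    ... | no  _ with () ← Bi
    apart : ∀ j i → B i ≡ true → Bs j i ≡ true → ⊥
    apart j i Bi Bji = All.lookup fixed (B-in-J i Bi) (free j i Bji)
    free-◂ : ∀ j → FreeBlock ρ ((B ◂ Bs) j)
    free-◂ zero    i Bi  = All.lookup (coords-free C) (B-in-J i Bi)
    free-◂ (suc j) i Bji = ⊑-Free ρ'⊑ρ (free j i Bji)
    flip-B : flip y B ≗ patch J (point C) y
    flip-B i with i ∈? J
    ... | yes _ = flip-diff y (point C) i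
    ... | no  _ = xor-identityʳ (y i)
    sensitive-◂ : ∀ j → Sensitive f y ((B ◂ Bs) j)
    sensitive-◂ zero f-flip≡fy = c≢fx0 (begin
      c                               ≡⟨ fy≡c ⟨
      f y                             ≡⟨ f-flip≡fy ⟨
      f (flip y B)                    ≡⟨ f-cong flip-B ⟩
      f (patch J (point C) y)         ≡⟨ certifies C _ (patch-∈C J (point-∈C C) y∈ρ) (patch-agrees J (point C) y) ⟩
      f (point C)                     ∎)
      where open ≡-Reasoning
    sensitive-◂ (suc j) = sensitive j

  BsPotential-zero⇒constant : ∀ {ρ} → BsPotential ρ 0 → ConstantOn f ρ
  BsPotential-zero⇒constant (zero  , _ , _  , bs₀ , _) = BsAtMost-zero⇒constant bs₀
  BsPotential-zero⇒constant (suc _ , _ , () , _)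

  BsPotential-decreasing : Decreasing BsPotential
  BsPotential-decreasing ρ k (zero , _ , _ , bs₀ , _) = inj₁ (BsAtMost-zero⇒constant bs₀)
  BsPotential-decreasing ρ k (suc _ , zero , _ , _ , bs₁) = inj₁ (BsAtMost-zero⇒constant bs₁)
  BsPotential-decreasing ρ k (suc k₀ , suc k₁ , k₀+k₁≡k , bs₀ , bs₁) = inj₂ drops
    where
    drops : ∀ C ρ' → Settles C ρ' → BsPotential ρ' k
    drops C ρ' settles with f (point C) in fx0
    ... | true  = k₀ , suc k₁ , suc-injective k₀+k₁≡k ,
                  BsAtMost-settle C settles (λ e → contradiction (trans e fx0) λ ()) bs₀ ,
                  BsAtMost-⊑ (proj₁ settles) bs₁
    ... | false = suc k₀ , k₁ , trans (sym (+-suc k₀ k₁)) (suc-injective k₀+k₁≡k) ,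
                  BsAtMost-⊑ (proj₁ settles) bs₀ ,
                  BsAtMost-settle C settles (λ e → contradiction (trans e fx0) λ ()) bs₁

  bs⇒BsPotential : ∀ {b} → BsIs f b → BsPotential (const nothing) (b + b)
  bs⇒BsPotential {b} bs = b , b , refl , bs-bound false , bs-bound true
    where
    bs-bound : ∀ c → BsAtMost (const nothing) c b
    bs-bound c y _ _ Bs disjoint _ sensitive = 1+n≰n (proj₂ bs (suc b) (y , Bs , disjoint , sensitive))

-- Discrete derivatives

∂ : List (Fin n) → (Input n → ℚ) → Input n → ℚ
∂ []      g z = g z
∂ (i ∷ S) g z = ∂ S g z -ℚ ∂ S g (flipAt z i)

∂-cong : ∀ (S : List (Fin n)) {g} → Congruent _≗_ _≡_ g → Congruent _≗_ _≡_ (∂ S g)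
∂-cong []      g-cong z≗z' = g-cong z≗z'
∂-cong (i ∷ S) g-cong z≗z' = cong₂ _-ℚ_ (∂-cong S g-cong z≗z') (∂-cong S g-cong (updateAt-resp-≗ i z≗z'))

∂-≗ : ∀ (S : List (Fin n)) {g h} → g ≗ h → ∂ S g ≗ ∂ S h
∂-≗ []      g≗h z = g≗h z
∂-≗ (i ∷ S) g≗h z = cong₂ _-ℚ_ (∂-≗ S g≗h z) (∂-≗ S g≗h (flipAt z i))

∂-scale : ∀ (S : List (Fin n)) c h z → ∂ S (λ x → c *ℚ h x) z ≡ c *ℚ ∂ S h z
∂-scale []      c h z = refl
∂-scale (i ∷ S) c h z =
  trans (cong₂ _-ℚ_ (∂-scale S c h z) (∂-scale S c h (flipAt z i))) (sym (*-distribˡ-minus c _ _))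
  where
  *-distribˡ-minus : ∀ c a b → c *ℚ (a -ℚ b) ≡ c *ℚ a -ℚ c *ℚ b
  *-distribˡ-minus = solve 3 (λ c a b → c :* (a :- b) := c :* a :- c :* b) refl

sumSubsets-zero : (u : (Fin n → Bool) → ℚ) → (∀ T → u T ≡ 0ℚ) → sumSubsets u ≡ 0ℚ
sumSubsets-zero {zero}  u u≡0 = u≡0 _
sumSubsets-zero {suc n} u u≡0 =
  trans (cong₂ _+ℚ_ (sumSubsets-zero (u ∘ (false ◂_)) (u≡0 ∘ (false ◂_))) (sumSubsets-zero (u ∘ (true ◂_)) (u≡0 ∘ (true ◂_))))
        (ℚ.+-identityˡ 0ℚ)

sumSubsets-minus : (u v : (Fin n → Bool) → ℚ) → sumSubsets (λ T → u T -ℚ v T) ≡ sumSubsets u -ℚ sumSubsets v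
sumSubsets-minus {zero}  u v = refl
sumSubsets-minus {suc n} u v =
  trans (cong₂ _+ℚ_ (sumSubsets-minus (u ∘ (false ◂_)) (v ∘ (false ◂_))) (sumSubsets-minus (u ∘ (true ◂_)) (v ∘ (true ◂_))))
        (interchange (sumSubsets (u ∘ (false ◂_))) (sumSubsets (v ∘ (false ◂_)))
                     (sumSubsets (u ∘ (true ◂_))) (sumSubsets (v ∘ (true ◂_))))
  where
  interchange : ∀ a b c d → (a -ℚ b) +ℚ (c -ℚ d) ≡ (a +ℚ c) -ℚ (b +ℚ d)
  interchange = solve 4 (λ a b c d → (a :- b) :+ (c :- d) := (a :+ c) :- (b :+ d)) refl

∂-sumSubsets : ∀ (S : List (Fin n)) (G : (Fin n → Bool) → Input n → ℚ) z →
               ∂ S (λ x → sumSubsets (λ T → G T x)) z ≡ sumSubsets (λ T → ∂ S (G T) z)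
∂-sumSubsets []      G z = refl
∂-sumSubsets (i ∷ S) G z =
  trans (cong₂ _-ℚ_ (∂-sumSubsets S G z) (∂-sumSubsets S G (flipAt z i)))
        (sym (sumSubsets-minus (λ T → ∂ S (G T) z) (λ T → ∂ S (G T) (flipAt z i))))

∂-flipAt : ∀ (S : List (Fin n)) {g} i → Congruent _≗_ _≡_ g → (∀ w → g (flipAt w i) ≡ g w) →
           ∀ z → ∂ S g (flipAt z i) ≡ ∂ S g z
∂-flipAt []      i g-cong invariant z = invariant z
∂-flipAt (j ∷ S) i g-cong invariant z = cong₂ _-ℚ_ (∂-flipAt S i g-cong invariant z) (begin
  ∂ S _ (flipAt (flipAt z i) j)   ≡⟨ ∂-cong S g-cong (flipAt-comm z i j) ⟩
  ∂ S _ (flipAt (flipAt z j) i)   ≡⟨ ∂-flipAt S i g-cong invariant (flipAt z j) ⟩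
  ∂ S _ (flipAt z j)              ∎)
  where open ≡-Reasoning

∂-vanishes : ∀ (S : List (Fin n)) {g} {i} → i ∈ S → Congruent _≗_ _≡_ g → (∀ w → g (flipAt w i) ≡ g w) →
             ∀ z → ∂ S g z ≡ 0ℚ
∂-vanishes (i ∷ S) (here refl) g-cong invariant z =
  trans (cong (∂ S _ z -ℚ_) (∂-flipAt S i g-cong invariant z)) (ℚ.+-inverseʳ (∂ S _ z))
∂-vanishes (j ∷ S) (there i∈S) g-cong invariant z =
  trans (cong₂ _-ℚ_ (∂-vanishes S i∈S g-cong invariant z) (∂-vanishes S i∈S g-cong invariant (flipAt z j)))
        (ℚ.+-inverseʳ 0ℚ)

∂-constant-on : (W : Input n → Set) {g : Input n → ℚ} → ∀ S →
                All (λ i → ∀ {w} → W w → W (flipAt w i)) S →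
                (∀ {w w'} → W w → W w' → g w ≡ g w') →
                ∀ {w w'} → W w → W w' → ∂ S g w ≡ ∂ S g w'
∂-constant-on W []      _                    g-constant = g-constant
∂-constant-on W (i ∷ S) (closed-i ∷ closed) g-constant w∈W w'∈W =
  cong₂ _-ℚ_ (∂S-constant w∈W w'∈W) (∂S-constant (closed-i w∈W) (closed-i w'∈W))
  where ∂S-constant = ∂-constant-on W S closed g-constant

monomial-cong : (T : Fin n → Bool) → Congruent _≗_ _≡_ (monomial T)
monomial-cong {zero}  T x≗y = refl
monomial-cong {suc n} T {x} {y} x≗y rewrite x≗y zero =
  cong ((if T zero then bit (y zero) else 1ℚ) *ℚ_) (monomial-cong (T ∘ suc) (x≗y ∘ suc))

monomial-flipAt : (T : Fin n → Bool) {i : Fin n} → T i ≡ false → ∀ x → monomial T (flipAt x i) ≡ monomial T x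
monomial-flipAt {suc n} T {zero}  Ti≡false x rewrite Ti≡false = refl
monomial-flipAt {suc n} T {suc i} Ti≡false x =
  cong ((if T zero then bit (x zero) else 1ℚ) *ℚ_) (monomial-flipAt (T ∘ suc) Ti≡false (x ∘ suc))

count-updateAt : (T : Fin n → Bool) {i : Fin n} → T i ≡ true → count T ≡ suc (count (updateAt T i (const false)))
count-updateAt {suc n} T {zero}  Ti≡true rewrite Ti≡true = refl
count-updateAt {suc n} T {suc i} Ti≡true =
  trans (cong ((if T zero then 1 else 0) +_) (count-updateAt (T ∘ suc) Ti≡true)) (+-suc _ _)

length≤count : (T : Fin n → Bool) {S : List (Fin n)} → Unique S → All (λ i → T i ≡ true) S → length S ≤ count T
length≤count T {[]}    _              _               = z≤n
length≤count T {i ∷ S} (i∉S ∷ unique) (Ti≡true ∷ in-T) = begin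
  suc (length S)                               ≤⟨ s≤s (length≤count T' unique (All.zipWith still-in-T (i∉S , in-T))) ⟩
  suc (count T')                               ≡⟨ count-updateAt T Ti≡true ⟨
  count T                                      ∎
  where
  open ≤-Reasoning
  T' = updateAt T i (const false)
  still-in-T : ∀ {j} → i ≢ j × T j ≡ true → T' j ≡ true
  still-in-T {j} (i≢j , Tj≡true) = trans (updateAt-minimal j i T (i≢j ∘ sym)) Tj≡true

bit-injective : ∀ {a b} → bit a ≡ bit b → a ≡ b
bit-injective {true}  {true}  _ = refl
bit-injective {false} {false} _ = refl
bit-injective {true}  {false} ()
bit-injective {false} {true}  ()

-- Degree

module Degree {n} (f : BFun n) (f-cong : Congruent _≗_ _≡_ f) (cs : ℕ) where
  open Construction f cs

  F : Input n → ℚ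
  F = bit ∘ f

  F-cong : Congruent _≗_ _≡_ F
  F-cong = cong bit ∘ f-cong

  -- deg(f|ρ) ≤ k, expressed through the derivatives along the free coordinates of ρ
  DegAtMost : Subcube n → ℕ → Set
  DegAtMost ρ k = ∀ S → Unique S → All (Free ρ) S → k < length S → ∀ z → z ∈C ρ → ∂ S F z ≡ 0ℚ

  deg⇒DegAtMost : ∀ {k} → DegIs f k → DegAtMost (const nothing) k
  deg⇒DegAtMost {k} (a , represents , bounded , _) S unique _ k<|S| z _ = begin
    ∂ S F z                                                ≡⟨ ∂-≗ S (sym ∘ represents) z ⟩
    ∂ S (evalPoly a) z                                     ≡⟨ ∂-sumSubsets S (λ T x → a T *ℚ monomial T x) z ⟩
    sumSubsets (λ T → ∂ S (λ x → a T *ℚ monomial T x) z)   ≡⟨ sumSubsets-zero _ term-vanishes ⟩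
    0ℚ                                                     ∎
    where
    open ≡-Reasoning
    -- a monomial of degree ≤ k < |S| misses some i ∈ S, and does not depend on x_i
    term-vanishes : ∀ T → ∂ S (λ x → a T *ℚ monomial T x) z ≡ 0ℚ
    term-vanishes T rewrite ∂-scale S (a T) (monomial T) z with a T ℚ.≟ 0ℚ | All.all? (λ i → T i ≟ᵇ true) S
    ... | yes aT≡0 | _        = trans (cong (_*ℚ ∂ S (monomial T) z) aT≡0) (ℚ.*-zeroˡ (∂ S (monomial T) z))
    ... | no  aT≢0 | yes S⊆T = contradiction (≤-trans (length≤count T unique S⊆T) (bounded T aT≢0)) (<⇒≱ k<|S|)
    ... | no  _    | no  S⊈T with find (¬All⇒Any¬ (λ i → T i ≟ᵇ true) S S⊈T)
    ...   | i , i∈S , Ti≢true =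
      trans (cong (a T *ℚ_) (∂-vanishes S i∈S (monomial-cong T) (monomial-flipAt T (¬-not Ti≢true)) z))
            (ℚ.*-zeroʳ (a T))

  DegAtMost-zero⇒constant : ∀ {ρ} → DegAtMost ρ 0 → ConstantOn f ρ
  DegAtMost-zero⇒constant {ρ} deg0 y z y∈ρ z∈ρ = begin
    f y                        ≡⟨ f-cong (λ i → patch-agrees (allFin n) y z (∈-allFin i)) ⟨
    f (patch (allFin n) y z)   ≡⟨ patch-preserves f f-cong (allFin n) y∈ρ overwrite z z∈ρ ⟩
    f z                        ∎
    where
    open ≡-Reasoning
    flip-preserves : ∀ {i} → Free ρ i → ∀ w → w ∈C ρ → f (flipAt w i) ≡ f w
    flip-preserves {i} free-i w w∈ρ =
      bit-injective (sym (x∙y⁻¹≈ε⇒x≈y _ _ (deg0 (i ∷ []) ([] ∷ []) (free-i ∷ []) (s≤s z≤n) w w∈ρ)))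
    overwrite : ∀ w j → w ∈C ρ → j ∈ allFin n → f (set w j (y j)) ≡ f w
    overwrite w j w∈ρ _ =
      set-preserves f f-cong w j (y j) λ wj≢yj → flip-preserves (≢⇒Free w∈ρ y∈ρ wj≢yj) w w∈ρ

  -- The certified points of ρ are closed under flipping S and f is constant on them.
  ∂-vanishes-where-certified : ∀ {ρ} (C : Certificate ρ) i S →
                               All (λ j → Free ρ j × ¬ j ∈ coords C) (i ∷ S) →
                               ∀ w → w ∈C ρ → AgreeOn (coords C) w (point C) → ∂ (i ∷ S) F w ≡ 0ℚ
  ∂-vanishes-where-certified {ρ} C i S (outside-i ∷ outside) w w∈ρ agree =
    trans (cong (∂ S F w -ℚ_) (sym (∂S-constant (w∈ρ , agree) (flip-closed outside-i (w∈ρ , agree)))))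
          (ℚ.+-inverseʳ (∂ S F w))
    where
    Certified : Input n → Set
    Certified w = w ∈C ρ × AgreeOn (coords C) w (point C)
    flip-closed : ∀ {j} → Free ρ j × ¬ j ∈ coords C → ∀ {w} → Certified w → Certified (flipAt w j)
    flip-closed (free-j , j∉J) (w∈ρ , agree) = flipAt-∈C free-j w∈ρ , flipAt-AgreeOn j∉J agree
    F-constant : ∀ {w w'} → Certified w → Certified w' → F w ≡ F w'
    F-constant (w∈ρ , agree) (w'∈ρ , agree') =
      cong bit (trans (certifies C _ w∈ρ agree) (sym (certifies C _ w'∈ρ agree')))
    ∂S-constant : ∀ {w w'} → Certified w → Certified w' → ∂ S F w ≡ ∂ S F w'
    ∂S-constant = ∂-constant-on Certified S (All.map flip-closed outside) F-constant

  -- Move z to the certificate one coordinate j at a time; each move changes ∂_S F by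
  -- ∂_{j ∷ S} F, a derivative of order > deg(f|ρ).
  DegAtMost-settle : ∀ {ρ ρ' k} (C : Certificate ρ) → Settles C ρ' → DegAtMost ρ (suc k) → DegAtMost ρ' k
  DegAtMost-settle {ρ} {ρ'} C (ρ'⊑ρ , fixed) deg (i ∷ S) unique free' k<|S| z z∈ρ' = begin
    ∂ (i ∷ S) F z                      ≡⟨ patch-preserves (∂ (i ∷ S) F) (∂-cong (i ∷ S) F-cong) J (point-∈C C)
                                                          overwrite z z∈ρ ⟨
    ∂ (i ∷ S) F (patch J (point C) z)  ≡⟨ ∂-vanishes-where-certified C i S (All.map outside free')
                                            (patch J (point C) z) (patch-∈C J (point-∈C C) z∈ρ)
                                            (patch-agrees J (point C) z) ⟩
    0ℚ                                 ∎
    where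
    open ≡-Reasoning
    J = coords C
    z∈ρ = ⊑-∈C ρ'⊑ρ z∈ρ'
    outside : ∀ {j} → Free ρ' j → Free ρ j × ¬ j ∈ J
    outside free-j = ⊑-Free ρ'⊑ρ free-j , λ j∈J → All.lookup fixed j∈J free-j
    overwrite : ∀ w j → w ∈C ρ → j ∈ J → ∂ (i ∷ S) F (set w j (point C j)) ≡ ∂ (i ∷ S) F w
    overwrite w j w∈ρ j∈J = set-preserves (∂ (i ∷ S) F) (∂-cong (i ∷ S) F-cong) w j (point C j) λ _ →
      sym (x∙y⁻¹≈ε⇒x≈y _ _
        (deg (j ∷ i ∷ S) (All.map (λ free-l j≡l → proj₂ (outside free-l) (subst (_∈ J) j≡l j∈J)) free' ∷ unique)
             (All.lookup (coords-free C) j∈J ∷ All.map (proj₁ ∘ outside) free') (s≤s k<|S|) w w∈ρ))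

  DegAtMost-decreasing : Decreasing DegAtMost
  DegAtMost-decreasing ρ k deg = inj₂ λ C ρ' settles → DegAtMost-settle C settles deg

module _ {n} {f : BFun n} {d cs : ℕ} (D-f : DIs f d) (cstar : CstarMinIs f cs) where
  open Construction f cs

  -- Without function extensionality this is not automatic: f agrees with a decision
  -- tree, which reads only the bits of its input.
  f-cong : Congruent _≗_ _≡_ f
  f-cong {x} {y} x≗y = trans (sym (computes x)) (trans (eval-cong t x≗y) (computes y))
    where
    t = proj₁ (proj₁ D-f)
    computes = proj₁ (proj₂ (proj₁ D-f))

  D≤potential : ∀ {Φ k} → (∀ {ρ} → Φ ρ 0 → ConstantOn f ρ) → Decreasing Φ → Φ (const nothing) k → d ≤ cs * k
  D≤potential {Φ} {k} zero-constant decreasing φ = decidable-stable (d ≤? cs * k) do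
    t , computes , depth≤ ← tree-from-potential (certificate f f-cong cstar) Φ zero-constant decreasing k _ φ
    pure (≤-trans (proj₂ D-f (depth t) (t , (λ x → computes x λ _ _ ()) , refl)) depth≤)

  D≤C*bs : ∀ {b} → BsIs f b → d ≤ 2 * cs * b
  D≤C*bs {b} bs = ≤-trans (D≤potential BsPotential-zero⇒constant BsPotential-decreasing (bs⇒BsPotential bs))
                          (≤-reflexive (*-double cs b))
    where
    open BlockSensitivity f f-cong cs
    *-double : ∀ c b → c * (b + b) ≡ 2 * c * b
    *-double = solve-∀

  D≤C*deg : ∀ {k} → DegIs f k → d ≤ 2 * cs * k
  D≤C*deg {k} deg = ≤-trans (D≤potential DegAtMost-zero⇒constant DegAtMost-decreasing (deg⇒DegAtMost deg))
                            (*-monoˡ-≤ k (m≤m+n cs (cs + 0)))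
    where open Degree f f-cong cs

lemma2 : Σ ℕ λ c → 0 < c ×
           ((n : ℕ) (f : BFun n) (d cs : ℕ) → DIs f d → CstarMinIs f cs →
             ((b : ℕ) → BsIs f b → d ≤ c * cs * b) ×
             ((k : ℕ) → DegIs f k → d ≤ c * cs * k))
lemma2 = 2 , s≤s z≤n , λ n f d cs D-f cstar → (λ _ → D≤C*bs D-f cstar) , (λ _ → D≤C*deg D-f cstar)
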